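{- For every integer $z\ge 1$ there exists a totally $(1,z)$-regular bipartite mixed graph of diameter $3$ with $2(z+1)^2$ vertices; that is, with $d=1+z$, it has $2(d^2-r+1)=2d^2$ vertices and so attains the bipartite mixed Moore bound for $r=1$ and diameter $k=3$.
   Context: A mixed graph $G$ consists of a finite vertex set $V$ together with a set of (undirected) edges (unordered pairs of distinct vertices) and a set of arcs (ordered pairs of distinct vertices), with no loops or multiple edges/arcs. A walk in $G$ is a directed walk in the digraph obtained by replacing each edge by two opposite arcs; distance and diameter are defined via shortest such walks (diameter = maximum distance over ordered pairs). $G$ is bipartite if $V$ can be partitioned into two sets such that every edge and arc joins different sets. $G$ is totally $(r,z)$-regular if each vertex is incident with exactly $r$ edges, and is the tail of exactly $z$ arcs and the head of exactly $z$ arcs. -}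

module Defs where

open import Data.Nat using (ℕ; zero; suc; _≤_)
open import Data.Fin using (Fin)
open import Data.Bool using (Bool; true; false; _∨_)
open import Data.List using (List; length; filterᵇ; allFin)
open import Data.Product using (Σ; ∃; _×_; _,_)
open import Relation.Binary.PropositionalEquality using (_≡_; _≢_)
open import Relation.Nullary using (¬_)

-- A mixed graph on the vertex set Fin n.
-- edge u v = true  : {u,v} is an (undirected) edge
-- arc  u v = true  : (u,v) is an arc with tail u and head v
-- No loops; edges are unordered pairs (symmetric); a pair of vertices
-- cannot carry both an edge and an arc (no multiple edges/arcs).
record MixedGraph (n : ℕ) : Set where
  field
    edge        : Fin n → Fin n → Bool
    arc         : Fin n → Fin n → Bool
    edge-sym    : ∀ u v → edge u v ≡ edge v u
    edge-irrefl : ∀ u → edge u u ≡ false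
    arc-irrefl  : ∀ u → arc u u ≡ false
    edge-no-arc : ∀ u v → edge u v ≡ true → arc u v ≡ false

open MixedGraph public

count : {n : ℕ} → (Fin n → Bool) → ℕ
count {n} p = length (filterᵇ p (allFin n))

step : {n : ℕ} → MixedGraph n → Fin n → Fin n → Bool
step G u v = edge G u v ∨ arc G u v

data Walk {n : ℕ} (G : MixedGraph n) : Fin n → Fin n → ℕ → Set where
  here  : ∀ {u} → Walk G u u zero
  there : ∀ {u w v ℓ} → step G u w ≡ true → Walk G w v ℓ → Walk G u v (suc ℓ)

DistLe : {n : ℕ} → MixedGraph n → Fin n → Fin n → ℕ → Set
DistLe G u v k = ∃ λ ℓ → ℓ ≤ k × Walk G u v ℓ

HasDiameter : {n : ℕ} → MixedGraph n → ℕ → Set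
HasDiameter G k =
  (∀ u v → DistLe G u v k) ×
  (∀ k′ → suc k′ ≤ k → ¬ (∀ u v → DistLe G u v k′))

Bipartite : {n : ℕ} → MixedGraph n → Set
Bipartite {n} G = Σ (Fin n → Bool) λ c →
  ∀ u v → step G u v ≡ true → c u ≢ c v

TotallyRegular : {n : ℕ} → MixedGraph n → ℕ → ℕ → Set
TotallyRegular G r z =
  (∀ u → count (edge G u) ≡ r) ×
  (∀ u → count (arc G u) ≡ z) ×
  (∀ v → count (λ u → arc G u v) ≡ z)

module Submission where

-- Take vertices (b , i , j) with a side b and coordinates i, j ∈ Fin (z + 1); the edge joins
-- (false , i , j) to (true , i , j), arcs leaving side false change i and arcs leaving side true
-- change j.  So (false , i , j) reaches every (true , k , j), and (true , i , j) every
-- (false , i , l), in one step (by the edge if the coordinate stays, by an arc otherwise), and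
-- chaining at most three such hops joins any two vertices.  Each degree is a product of two
-- coordinate counts, 1 · 1 for edges and z · 1 for arcs.  Distance 3 is attained because a
-- walk of length 2 stays on one side and a vertex has non-neighbours on the other side.

open import Defs
open import Data.Bool using (Bool; true; false; not; _∧_; _∨_; _xor_)
open import Data.Bool.Properties
  using (xor-comm; xor-same; ∨-inverseʳ; ∧-zeroʳ; ∧-identityʳ; ¬-not; not-involutive)
open import Data.Fin using (Fin; zero; suc; _↑ˡ_; _↑ʳ_; combine; remQuot)
open import Data.Fin.Properties using (_≟_; remQuot-combine; *↔×; 2↔Bool; 0≢1+n)
open import Data.List using (length; filterᵇ; tabulate)
open import Data.Nat using (ℕ; zero; suc; _+_; _*_; _^_; _≤_; s≤s)
open import Data.Nat.Properties
  using ( +-assoc; +-identityʳ; *-identityʳ; *-identityˡ; *-zeroʳ; *-distribˡ-+; *-distribʳ-+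
        ; ≤-refl; ≤-trans; n≤1+n)
open import Data.Product using (Σ; _×_; _,_; proj₁)
open import Data.Product.Function.NonDependent.Propositional using (_×-↔_)
open import Function using (_∘_; mk⇔)
open import Function.Bundles using (_↔_; Inverse)
open import Function.Construct.Composition using (_↔-∘_)
open import Relation.Binary.PropositionalEquality
open import Relation.Nullary using (¬_; does; contradiction)
open import Relation.Nullary.Decidable using (dec-true; dec-false; does-⇔)

∑ : ∀ n → (Fin n → ℕ) → ℕ
∑ zero    f = 0
∑ (suc n) f = f zero + ∑ n (f ∘ suc)

∑-cong : ∀ n {f g : Fin n → ℕ} → (∀ i → f i ≡ g i) → ∑ n f ≡ ∑ n g
∑-cong zero    f≗g = refl
∑-cong (suc n) f≗g = cong₂ _+_ (f≗g zero) (∑-cong n (f≗g ∘ suc))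

∑-const : ∀ n c → ∑ n (λ _ → c) ≡ n * c
∑-const zero    c = refl
∑-const (suc n) c = cong (c +_) (∑-const n c)

∑-zero : ∀ n → ∑ n (λ _ → 0) ≡ 0
∑-zero n = trans (∑-const n 0) (*-zeroʳ n)

∑-*ʳ : ∀ n (f : Fin n → ℕ) c → ∑ n (λ i → f i * c) ≡ ∑ n f * c
∑-*ʳ zero    f c = refl
∑-*ʳ (suc n) f c =
  trans (cong (f zero * c +_) (∑-*ʳ n (f ∘ suc) c)) (sym (*-distribʳ-+ c (f zero) _))

∑-*ˡ : ∀ n c (f : Fin n → ℕ) → ∑ n (λ i → c * f i) ≡ c * ∑ n f
∑-*ˡ zero    c f = sym (*-zeroʳ c)
∑-*ˡ (suc n) c f =
  trans (cong (c * f zero +_) (∑-*ˡ n c (f ∘ suc))) (sym (*-distribˡ-+ c (f zero) _))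

∑∑-* : ∀ m n (f : Fin m → ℕ) (g : Fin n → ℕ) →
  ∑ m (λ i → ∑ n (λ j → f i * g j)) ≡ ∑ m f * ∑ n g
∑∑-* m n f g = trans (∑-cong m (λ i → ∑-*ˡ n (f i) g)) (∑-*ʳ m f (∑ n g))

∑-↑ : ∀ m n (f : Fin (m + n) → ℕ) → ∑ (m + n) f ≡ ∑ m (f ∘ (_↑ˡ n)) + ∑ n (f ∘ (m ↑ʳ_))
∑-↑ zero    n f = refl
∑-↑ (suc m) n f = trans (cong (f zero +_) (∑-↑ m n (f ∘ suc))) (sym (+-assoc (f zero) _ _))

∑-combine : ∀ m n (f : Fin (m * n) → ℕ) → ∑ (m * n) f ≡ ∑ m (λ i → ∑ n (λ j → f (combine i j)))
∑-combine zero    n f = refl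
∑-combine (suc m) n f =
  trans (∑-↑ n (m * n) f) (cong (∑ n (f ∘ (_↑ˡ (m * n))) +_) (∑-combine m n (f ∘ (n ↑ʳ_))))

∑-remQuot : ∀ m n (g : Fin m × Fin n → ℕ) →
  ∑ (m * n) (g ∘ remQuot n) ≡ ∑ m (λ i → ∑ n (λ j → g (i , j)))
∑-remQuot m n g = trans (∑-combine m n (g ∘ remQuot n))
  (∑-cong m (λ i → ∑-cong n (λ j → cong g (remQuot-combine i j))))

𝟙 : Bool → ℕ
𝟙 true  = 1
𝟙 false = 0

𝟙-∧ : ∀ a b → 𝟙 (a ∧ b) ≡ 𝟙 a * 𝟙 b
𝟙-∧ true  b = sym (+-identityʳ (𝟙 b))
𝟙-∧ false b = refl

∑∑-𝟙-∧ : ∀ m n (p : Fin m → Bool) (q : Fin n → Bool) →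
  ∑ m (λ i → ∑ n (λ j → 𝟙 (p i ∧ q j))) ≡ ∑ m (𝟙 ∘ p) * ∑ n (𝟙 ∘ q)
∑∑-𝟙-∧ m n p q =
  trans (∑-cong m (λ i → ∑-cong n (λ j → 𝟙-∧ (p i) (q j)))) (∑∑-* m n (𝟙 ∘ p) (𝟙 ∘ q))

length-filterᵇ-tabulate : ∀ {A : Set} n (q : A → Bool) (f : Fin n → A) →
  length (filterᵇ q (tabulate f)) ≡ ∑ n (𝟙 ∘ q ∘ f)
length-filterᵇ-tabulate zero    q f = refl
length-filterᵇ-tabulate (suc n) q f with q (f zero)
... | true  = cong suc (length-filterᵇ-tabulate n q (f ∘ suc))
... | false = length-filterᵇ-tabulate n q (f ∘ suc)

count≡∑ : ∀ {n} (q : Fin n → Bool) → count q ≡ ∑ n (𝟙 ∘ q)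
count≡∑ {n} q = length-filterᵇ-tabulate n q (λ i → i)

_≡ᵇ_ : ∀ {n} → Fin n → Fin n → Bool
i ≡ᵇ j = does (i ≟ j)

≡ᵇ-sym : ∀ {n} (i j : Fin n) → i ≡ᵇ j ≡ j ≡ᵇ i
≡ᵇ-sym i j = does-⇔ (mk⇔ sym sym) (i ≟ j) (j ≟ i)

∑-𝟙-≡ᵇʳ : ∀ {n} (i : Fin n) → ∑ n (λ j → 𝟙 (i ≡ᵇ j)) ≡ 1
∑-𝟙-≡ᵇʳ {suc n} zero    = cong suc (∑-zero n)
∑-𝟙-≡ᵇʳ {suc n} (suc i) = ∑-𝟙-≡ᵇʳ i

∑-𝟙-≢ᵇʳ : ∀ {n} (i : Fin (suc n)) → ∑ (suc n) (λ j → 𝟙 (not (i ≡ᵇ j))) ≡ n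
∑-𝟙-≢ᵇʳ {n}     zero    = trans (∑-const n 1) (*-identityʳ n)
∑-𝟙-≢ᵇʳ {suc n} (suc i) = cong suc (∑-𝟙-≢ᵇʳ i)

∑-𝟙-≡ᵇˡ : ∀ {n} (j : Fin n) → ∑ n (λ i → 𝟙 (i ≡ᵇ j)) ≡ 1
∑-𝟙-≡ᵇˡ {n} j = trans (∑-cong n (λ i → cong 𝟙 (≡ᵇ-sym i j))) (∑-𝟙-≡ᵇʳ j)

∑-𝟙-≢ᵇˡ : ∀ {n} (j : Fin (suc n)) → ∑ (suc n) (λ i → 𝟙 (not (i ≡ᵇ j))) ≡ n
∑-𝟙-≢ᵇˡ {n} j = trans (∑-cong (suc n) (λ i → cong (𝟙 ∘ not) (≡ᵇ-sym i j))) (∑-𝟙-≢ᵇʳ j)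

module _ {n} (G : MixedGraph n) (colour : Fin n → Bool)
         (proper : ∀ u v → step G u v ≡ true → colour u ≢ colour v) where

  no-walk≤2 : ∀ {u v ℓ} → colour u ≢ colour v → step G u v ≡ false → ℓ ≤ 2 → ¬ Walk G u v ℓ
  no-walk≤2 opposite u≁v _ here = opposite refl
  no-walk≤2 opposite u≁v _ (there u→v here) = contradiction (trans (sym u≁v) u→v) λ ()
  no-walk≤2 {u} {v} opposite u≁v _ (there {w = w} u→w (there w→v here)) =
    opposite (begin
      colour u             ≡⟨ ¬-not (proper u w u→w) ⟩
      not (colour w)       ≡⟨ cong not (¬-not (proper w v w→v)) ⟩
      not (not (colour v)) ≡⟨ not-involutive (colour v) ⟩
      colour v             ∎)
    where open ≡-Reasoning
  no-walk≤2 opposite u≁v (s≤s (s≤s ())) (there _ (there _ (there _ _)))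

  diameter≥3 : ∀ {u v} → colour u ≢ colour v → step G u v ≡ false →
    ∀ k′ → suc k′ ≤ 3 → ¬ (∀ x y → DistLe G x y k′)
  diameter≥3 {u} {v} opposite u≁v _ (s≤s k′≤2) dist≤k′ with dist≤k′ u v
  ... | ℓ , ℓ≤k′ , walk = no-walk≤2 opposite u≁v (≤-trans ℓ≤k′ k′≤2) walk

module Construction (z : ℕ) where

  d : ℕ
  d = suc z

  Vertex : Set
  Vertex = Bool × Fin d × Fin d

  edgeᵛ : Vertex → Vertex → Bool
  edgeᵛ (a , i , j) (b , k , l) = (a xor b) ∧ (i ≡ᵇ k ∧ j ≡ᵇ l)

  arcᵛ : Vertex → Vertex → Bool
  arcᵛ (false , i , j) (true  , k , l) = not (i ≡ᵇ k) ∧ j ≡ᵇ l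
  arcᵛ (true  , i , j) (false , k , l) = i ≡ᵇ k ∧ not (j ≡ᵇ l)
  arcᵛ (false , _)     (false , _)     = false
  arcᵛ (true  , _)     (true  , _)     = false

  stepᵛ : Vertex → Vertex → Bool
  stepᵛ s t = edgeᵛ s t ∨ arcᵛ s t

  edgeᵛ-sym : ∀ s t → edgeᵛ s t ≡ edgeᵛ t s
  edgeᵛ-sym (a , i , j) (b , k , l)
    rewrite xor-comm a b | ≡ᵇ-sym i k | ≡ᵇ-sym j l = refl

  edgeᵛ-irrefl : ∀ s → edgeᵛ s s ≡ false
  edgeᵛ-irrefl (a , _) rewrite xor-same a = refl

  arcᵛ-irrefl : ∀ s → arcᵛ s s ≡ false
  arcᵛ-irrefl (false , _) = refl
  arcᵛ-irrefl (true  , _) = refl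

  edgeᵛ⇒¬arcᵛ : ∀ s t → edgeᵛ s t ≡ true → arcᵛ s t ≡ false
  edgeᵛ⇒¬arcᵛ (false , _) (false , _) _ = refl
  edgeᵛ⇒¬arcᵛ (true  , _) (true  , _) _ = refl
  edgeᵛ⇒¬arcᵛ (false , i , j) (true , k , l) e with i ≡ᵇ k
  ... | true  = refl
  ... | false = contradiction e λ ()
  edgeᵛ⇒¬arcᵛ (true , i , j) (false , k , l) e with i ≡ᵇ k | j ≡ᵇ l
  ... | false | _     = refl
  ... | true  | true  = refl
  ... | true  | false = contradiction e λ ()

  stepᵛ-crosses : ∀ s t → stepᵛ s t ≡ true → proj₁ s ≢ proj₁ t
  stepᵛ-crosses (false , _) (true  , _) _ ()
  stepᵛ-crosses (true  , _) (false , _) _ ()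

  stepᵛ-↑ : ∀ i k j → stepᵛ (false , i , j) (true , k , j) ≡ true
  stepᵛ-↑ i k j rewrite dec-true (j ≟ j) refl
                   | ∧-identityʳ (i ≡ᵇ k) | ∧-identityʳ (not (i ≡ᵇ k)) = ∨-inverseʳ (i ≡ᵇ k)

  stepᵛ-↓ : ∀ i j l → stepᵛ (true , i , j) (false , i , l) ≡ true
  stepᵛ-↓ i j l rewrite dec-true (i ≟ i) refl = ∨-inverseʳ (j ≡ᵇ l)

  nonadjacent : ∀ i k {j l} → j ≢ l → stepᵛ (false , i , j) (true , k , l) ≡ false
  nonadjacent i k {j} {l} j≢l
    rewrite dec-false (j ≟ l) j≢l | ∧-zeroʳ (i ≡ᵇ k) | ∧-zeroʳ (not (i ≡ᵇ k)) = refl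

  vertices : Fin (2 * (d * d)) ↔ Vertex
  vertices = (2↔Bool ×-↔ *↔×) ↔-∘ *↔×

  open Inverse vertices using (to; from; strictlyInverseˡ; strictlyInverseʳ)

  G : MixedGraph (2 * (d * d))
  G = record
    { edge        = λ u v → edgeᵛ (to u) (to v)
    ; arc         = λ u v → arcᵛ (to u) (to v)
    ; edge-sym    = λ u v → edgeᵛ-sym (to u) (to v)
    ; edge-irrefl = edgeᵛ-irrefl ∘ to
    ; arc-irrefl  = arcᵛ-irrefl ∘ to
    ; edge-no-arc = λ u v → edgeᵛ⇒¬arcᵛ (to u) (to v)
    }

  ∑ᵛ : (Vertex → ℕ) → ℕ
  ∑ᵛ g = ∑ d (λ i → ∑ d (λ j → g (false , i , j))) + ∑ d (λ i → ∑ d (λ j → g (true , i , j)))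

  count∘to : ∀ (q : Vertex → Bool) → count (q ∘ to) ≡ ∑ᵛ (𝟙 ∘ q)
  count∘to q = begin
    count (q ∘ to)
      ≡⟨ count≡∑ (q ∘ to) ⟩
    ∑ (2 * (d * d)) (𝟙 ∘ q ∘ to)
      ≡⟨ ∑-remQuot 2 (d * d) (λ (a , r) → 𝟙 (q (bool a , remQuot d r))) ⟩
    ∑ 2 (λ a → ∑ (d * d) (λ r → 𝟙 (q (bool a , remQuot d r))))
      ≡⟨ ∑-cong 2 (λ a → ∑-remQuot d d (λ (i , j) → 𝟙 (q (bool a , i , j)))) ⟩
    ∑ 2 (λ a → ∑ d (λ i → ∑ d (λ j → 𝟙 (q (bool a , i , j)))))
      ≡⟨ cong (∑ d (λ i → ∑ d (λ j → 𝟙 (q (false , i , j)))) +_) (+-identityʳ _) ⟩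
    ∑ᵛ (𝟙 ∘ q)
      ∎
    where
    open ≡-Reasoning
    bool : Fin 2 → Bool
    bool = Inverse.to 2↔Bool

  ∑∑-zero : ∑ d (λ _ → ∑ d (λ _ → 0)) ≡ 0
  ∑∑-zero = trans (∑-cong d (λ _ → ∑-zero d)) (∑-zero d)

  -- Every neighbourhood is, definitionally, of one of the following two shapes.
  ∑ᵛ-true-layer : ∀ (p q : Fin d → Bool) →
    ∑ᵛ (λ (b , k , l) → 𝟙 (b ∧ (p k ∧ q l))) ≡ ∑ d (𝟙 ∘ p) * ∑ d (𝟙 ∘ q)
  ∑ᵛ-true-layer p q = cong₂ _+_ ∑∑-zero (∑∑-𝟙-∧ d d p q)

  ∑ᵛ-false-layer : ∀ (p q : Fin d → Bool) →
    ∑ᵛ (λ (b , k , l) → 𝟙 (not b ∧ (p k ∧ q l))) ≡ ∑ d (𝟙 ∘ p) * ∑ d (𝟙 ∘ q)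
  ∑ᵛ-false-layer p q = trans (cong₂ _+_ (∑∑-𝟙-∧ d d p q) ∑∑-zero) (+-identityʳ _)

  edge-degree : ∀ s → ∑ᵛ (𝟙 ∘ edgeᵛ s) ≡ 1
  edge-degree (false , i , j) =
    trans (∑ᵛ-true-layer (i ≡ᵇ_) (j ≡ᵇ_)) (cong₂ _*_ (∑-𝟙-≡ᵇʳ i) (∑-𝟙-≡ᵇʳ j))
  edge-degree (true , i , j) =
    trans (∑ᵛ-false-layer (i ≡ᵇ_) (j ≡ᵇ_)) (cong₂ _*_ (∑-𝟙-≡ᵇʳ i) (∑-𝟙-≡ᵇʳ j))

  out-degree : ∀ s → ∑ᵛ (𝟙 ∘ arcᵛ s) ≡ z
  out-degree (false , i , j) =
    trans (∑ᵛ-true-layer (not ∘ (i ≡ᵇ_)) (j ≡ᵇ_))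
          (trans (cong₂ _*_ (∑-𝟙-≢ᵇʳ i) (∑-𝟙-≡ᵇʳ j)) (*-identityʳ z))
  out-degree (true , i , j) =
    trans (∑ᵛ-false-layer (i ≡ᵇ_) (not ∘ (j ≡ᵇ_)))
          (trans (cong₂ _*_ (∑-𝟙-≡ᵇʳ i) (∑-𝟙-≢ᵇʳ j)) (*-identityˡ z))

  in-degree : ∀ t → ∑ᵛ (λ s → 𝟙 (arcᵛ s t)) ≡ z
  in-degree (false , k , l) =
    trans (∑ᵛ-true-layer (_≡ᵇ k) (not ∘ (_≡ᵇ l)))
          (trans (cong₂ _*_ (∑-𝟙-≡ᵇˡ k) (∑-𝟙-≢ᵇˡ l)) (*-identityˡ z))
  in-degree (true , k , l) =
    trans (∑ᵛ-false-layer (not ∘ (_≡ᵇ k)) (_≡ᵇ l))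
          (trans (cong₂ _*_ (∑-𝟙-≢ᵇˡ k) (∑-𝟙-≡ᵇˡ l)) (*-identityʳ z))

  totally-regular : TotallyRegular G 1 z
  totally-regular =
    (λ u → trans (count∘to (edgeᵛ (to u))) (edge-degree (to u))) ,
    (λ u → trans (count∘to (arcᵛ (to u))) (out-degree (to u))) ,
    (λ v → trans (count∘to (λ s → arcᵛ s (to v))) (in-degree (to v)))

  side : Fin (2 * (d * d)) → Bool
  side = proj₁ ∘ to

  side-proper : ∀ u v → step G u v ≡ true → side u ≢ side v
  side-proper u v = stepᵛ-crosses (to u) (to v)

  bipartite : Bipartite G
  bipartite = side , side-proper

  step-from : ∀ s t → step G (from s) (from t) ≡ stepᵛ s t
  step-from s t = cong₂ stepᵛ (strictlyInverseˡ s) (strictlyInverseˡ t)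

  side-from : ∀ s → side (from s) ≡ proj₁ s
  side-from s = cong proj₁ (strictlyInverseˡ s)

  hop↑ : ∀ {v ℓ} i k j → Walk G (from (true , k , j)) v ℓ → Walk G (from (false , i , j)) v (suc ℓ)
  hop↑ i k j = there (trans (step-from (false , i , j) (true , k , j)) (stepᵛ-↑ i k j))

  hop↓ : ∀ {v ℓ} i j l → Walk G (from (false , i , l)) v ℓ → Walk G (from (true , i , j)) v (suc ℓ)
  hop↓ i j l = there (trans (step-from (true , i , j) (false , i , l)) (stepᵛ-↓ i j l))

  reach : ∀ s t → DistLe G (from s) (from t) 3
  reach (false , i , j) (false , k , l) =
    2 , n≤1+n 2 , hop↑ i k j (hop↓ k j l here)
  reach (false , i , j) (true , k , l) =
    3 , ≤-refl , hop↑ i k j (hop↓ k j l (hop↑ k k l here))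
  reach (true , i , j) (false , k , l) =
    3 , ≤-refl , hop↓ i j j (hop↑ i k j (hop↓ k j l here))
  reach (true , i , j) (true , k , l) =
    2 , n≤1+n 2 , hop↓ i j l (hop↑ i k l here)

  within-3 : ∀ u v → DistLe G u v 3
  within-3 u v =
    subst₂ (λ x y → DistLe G x y 3) (strictlyInverseʳ u) (strictlyInverseʳ v) (reach (to u) (to v))

  diameter : ∀ {j l : Fin d} → j ≢ l → HasDiameter G 3
  diameter {j} {l} j≢l = within-3 , diameter≥3 G side side-proper {u} {v} opposite u≁v
    where
    u v : Fin (2 * (d * d))
    u = from (false , j , j)
    v = from (true , j , l)
    opposite : side u ≢ side v
    opposite = subst₂ _≢_ (sym (side-from (false , j , j))) (sym (side-from (true , j , l))) λ ()
    u≁v : step G u v ≡ false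
    u≁v = trans (step-from (false , j , j) (true , j , l)) (nonadjacent j j j≢l)

proposition4 : (z : ℕ) → 1 ≤ z →
    Σ (MixedGraph (2 * (suc z) ^ 2)) λ G →
      TotallyRegular G 1 z × Bipartite G × HasDiameter G 3
proposition4 z@(suc _) _ =
  subst (λ n → Σ (MixedGraph n) λ G → TotallyRegular G 1 z × Bipartite G × HasDiameter G 3)
        (cong (λ m → 2 * (suc z * m)) (sym (*-identityʳ (suc z))))
        (G , totally-regular , bipartite , diameter (0≢1+n {i = zero}))
  where open Construction z
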